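{- Let $q$ be an indeterminate and let $m,n,k\geq 0$ be integers. Then $$\binom{m+n}{k}_q\binom{m+n+1}{n}_q-\binom{m}{k}_q\binom{k+m+n+1}{n}_q=\sum_{i=1}^n\sum_{j=1}^{k}q^{i(j+m+1)-2j(k-j+1)}\binom{m}{j-1}_q\binom{k+1}{j}_q\binom{i-1}{k-j}_q\binom{m+n+j-i}{n-i}_q.$$
   Context: For an integer $a\ge1$, $a_q=1+q+\cdots+q^{a-1}$, $a_q!=\prod_{i=1}^a i_q$, $0_q!=1$. The $q$-binomial coefficient is $\binom{n}{k}_q=\frac{n_q!}{k_q!(n-k)_q!}$ for $0\le k\le n$, $\binom{n}{0}_q=1$ for all integers $n$, and $\binom{n}{k}_q=0$ otherwise. -}

module Defs where

open import Algebra.Bundles using (CommutativeRing)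
open import Data.Nat as ℕ using (ℕ; zero; suc)
open import Data.Integer as ℤ using (ℤ; +_; -[1+_])

-- Everything is stated in an arbitrary commutative ring R with a unit q
-- (q * qinv ≈ 1#); taking R = ℤ[q,q⁻¹] this is exactly the identity of
-- Laurent polynomials in the indeterminate q.
module QCalc {c ℓ} (R : CommutativeRing c ℓ) where
  open CommutativeRing R public using (Carrier; _≈_; 0#; 1#)
    renaming (_+_ to _⊕_; _*_ to _⊗_; _-_ to _⊖_)

  pow : Carrier → ℕ → Carrier
  pow x zero    = 1#
  pow x (suc n) = x ⊗ pow x n

  zpow : Carrier → Carrier → ℤ → Carrier
  zpow q qinv (+ n)     = pow q n
  zpow q qinv -[1+ n ]  = pow qinv (suc n)

  qint : Carrier → ℕ → Carrier
  qint q zero    = 0#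
  qint q (suc a) = qint q a ⊕ pow q a

  qfact : Carrier → ℕ → Carrier
  qfact q zero    = 1#
  qfact q (suc a) = qfact q a ⊗ qint q (suc a)

  -- This is the polynomial n_q!/(k_q!(n-k)_q!) for k ≤ n and 0 for k > n.
  qbin : Carrier → ℕ → ℕ → Carrier
  qbin q n       zero    = 1#
  qbin q zero    (suc k) = 0#
  qbin q (suc n) (suc k) = qbin q n k ⊕ pow q (suc k) ⊗ qbin q n (suc k)

  Σ1 : ℕ → (ℕ → Carrier) → Carrier
  Σ1 zero    f = 0#
  Σ1 (suc n) f = Σ1 n f ⊕ f (suc n)

expo : ℕ → ℕ → ℕ → ℕ → ℤ
expo m k i j =
  (+ i) ℤ.* (+ j ℤ.+ + m ℤ.+ + 1) ℤ.- (+ 2) ℤ.* (+ j) ℤ.* (+ k ℤ.- + j ℤ.+ + 1)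

module Submission where

-- With X = m + n and ⟦ X+1 , n ⟧ = ⟦ X+1 , m+1 ⟧, the first product is expanded by the product formula
--   ⟦ X , k ⟧ ⟦ X+1 , m+1 ⟧ = Σ_{a ≤ k} q^((k-a)(m-a)) ⟦ m , a ⟧ ⟦ k+1 , a+1 ⟧ ⟦ X+1+a , k+m+1 ⟧,
-- proved by induction on X: Pascal's rule on both factors, a three-term recurrence for the coefficients
-- and summation by parts. Its term a = k is the subtracted product. The q-Chu-Vandermonde identity
-- expands each remaining ⟦ X+1+a , k+m+1 ⟧ as a sum over i, and with j = a+1 the resulting double sum
-- is the right-hand side: the exponent of q is (k-a)(m-a) plus the Vandermonde weight.

open import Defs
open import Algebra.Bundles using (CommutativeRing)
open import Data.Nat using (ℕ; _+_; _∸_)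

open import Data.Nat using (zero; suc; _*_; _≤_; _<_; _<?_; _≤?_; z≤n; s≤s)
import Data.Nat.Properties as ℕₚ
open import Data.Nat.Properties
  using (m≤n+m; m≤m+n; m+n∸n≡m; m+n∸m≡n; m≤n⇒∃[o]m+o≡n; m∸n+n≡m; n∸n≡0; ≰⇒>; [m+n]∸[m+o]≡n∸o)
open import Data.Nat.Tactic.RingSolver using (solve-∀) renaming (solve to solveℕ)
open import Data.Integer as ℤ using (+_)
open import Data.Integer.Properties using (pos-+; pos-*; [+m]-[+n]≡m⊖n; ⊖-≥)
open import Data.List using (_∷_; [])
open import Data.Product using (_,_)
open import Relation.Nullary using (yes; no)
open import Relation.Binary.PropositionalEquality as ≡ using (_≡_; cong; cong₂; subst)

suc[m+n]∸m≡suc[n] : ∀ m n → suc (m + n) ∸ m ≡ suc n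
suc[m+n]∸m≡suc[n] m n = ≡.trans (cong (_∸ m) (≡.sym (ℕₚ.+-suc m n))) (m+n∸m≡n m (suc n))

expo≡⊖ : ∀ m k i j → j ≤ k → expo m k i j ≡ i * (j + m + 1) ℤ.⊖ 2 * j * (k ∸ j + 1)
expo≡⊖ m k i j j≤k = begin
  + i ℤ.* (+ j ℤ.+ + m ℤ.+ + 1) ℤ.- + 2 ℤ.* + j ℤ.* (+ k ℤ.- + j ℤ.+ + 1)
    ≡⟨ cong₂ (λ x y → + i ℤ.* x ℤ.- + 2 ℤ.* + j ℤ.* y) j+m+1 k-j+1 ⟩
  + i ℤ.* + (j + m + 1) ℤ.- + 2 ℤ.* + j ℤ.* + (k ∸ j + 1)
    ≡⟨ cong₂ ℤ._-_ (≡.sym (pos-* i _)) 2*j*[k-j+1] ⟩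
  + (i * (j + m + 1)) ℤ.- + (2 * j * (k ∸ j + 1))
    ≡⟨ [+m]-[+n]≡m⊖n (i * (j + m + 1)) (2 * j * (k ∸ j + 1)) ⟩
  i * (j + m + 1) ℤ.⊖ 2 * j * (k ∸ j + 1) ∎
  where
  open ≡.≡-Reasoning
  j+m+1 : + j ℤ.+ + m ℤ.+ + 1 ≡ + (j + m + 1)
  j+m+1 = ≡.sym (≡.trans (pos-+ (j + m) 1) (cong (ℤ._+ + 1) (pos-+ j m)))
  k-j+1 : + k ℤ.- + j ℤ.+ + 1 ≡ + (k ∸ j + 1)
  k-j+1 = ≡.trans (cong (ℤ._+ + 1) (≡.trans ([+m]-[+n]≡m⊖n k j) (⊖-≥ j≤k))) (≡.sym (pos-+ (k ∸ j) 1))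
  2*j*[k-j+1] : + 2 ℤ.* + j ℤ.* + (k ∸ j + 1) ≡ + (2 * j * (k ∸ j + 1))
  2*j*[k-j+1] = ≡.sym (≡.trans (pos-* (2 * j) _) (cong (ℤ._* + (k ∸ j + 1)) (pos-* 2 j)))

[e+b]⊖b≡e : ∀ e b → (e + b) ℤ.⊖ b ≡ + e
[e+b]⊖b≡e e b = ≡.trans (⊖-≥ (m≤n+m b e)) (cong +_ (m+n∸n≡m e b))

-- Where the summand of the theorem does not vanish its exponent is nonnegative: it is the exponent of
-- the product-formula coefficient plus that of the q-Vandermonde weight.
expo≡+ : ∀ m k i j → j < k → j ≤ m → k ∸ suc j ≤ i →
  expo m k (suc i) (suc j) ≡ + ((k ∸ j) * (m ∸ j) + (i ∸ (k ∸ suc j)) * suc (m + suc j))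
expo≡+ m k i j j<k j≤m k-j≤i with m≤n⇒∃[o]m+o≡n j<k | m≤n⇒∃[o]m+o≡n j≤m
... | w , ≡.refl | v , ≡.refl
  with m≤n⇒∃[o]m+o≡n (subst (_≤ i) (m+n∸m≡n (suc j) w) k-j≤i)
... | t , ≡.refl
  rewrite m+n∸m≡n j w | m+n∸m≡n w t | m+n∸m≡n j v = begin
    expo (j + v) (suc j + w) (suc (w + t)) (suc j)
      ≡⟨ expo≡⊖ (j + v) (suc j + w) (suc (w + t)) (suc j) (m≤m+n (suc j) w) ⟩
    suc (w + t) * (suc j + (j + v) + 1) ℤ.⊖ 2 * suc j * (j + w ∸ j + 1)
      ≡⟨ cong (λ x → suc (w + t) * (suc j + (j + v) + 1) ℤ.⊖ 2 * suc j * (x + 1)) (m+n∸m≡n j w) ⟩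
    suc (w + t) * (suc j + (j + v) + 1) ℤ.⊖ 2 * suc j * (w + 1)
      ≡⟨ cong (ℤ._⊖ 2 * suc j * (w + 1)) (expand j v w t) ⟩
    (suc w * v + t * suc (j + v + suc j)) + 2 * suc j * (w + 1) ℤ.⊖ 2 * suc j * (w + 1)
      ≡⟨ [e+b]⊖b≡e (suc w * v + t * suc (j + v + suc j)) (2 * suc j * (w + 1)) ⟩
    + (suc w * v + t * suc (j + v + suc j))
      ≡⟨ cong (λ x → + (x * v + t * suc (j + v + suc j))) (≡.sym (suc[m+n]∸m≡suc[n] j w)) ⟩
    + ((suc (j + w) ∸ j) * v + t * suc (j + v + suc j)) ∎
  where
  open ≡.≡-Reasoning
  expand : ∀ j v w t → suc (w + t) * (suc j + (j + v) + 1) ≡ (suc w * v + t * suc (j + v + suc j)) + 2 * suc j * (w + 1)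
  expand = solve-∀

vandermonde-index : ∀ {i n} m a → i < n → m + n + suc a ∸ suc i ≡ (n ∸ suc i) + (m + suc a)
vandermonde-index {i} m a i<n with m≤n⇒∃[o]m+o≡n i<n
... | r , ≡.refl rewrite m+n∸m≡n i r =
  ≡.trans (cong (_∸ suc i) (rearrange m i r a)) (m+n∸m≡n (suc i) (r + (m + suc a)))
  where
  rearrange : ∀ m i r a → m + (suc i + r) + suc a ≡ suc i + (r + (m + suc a))
  rearrange = solve-∀

[k∸suc[a]]+suc[m+suc[a]]≡suc[k+m] : ∀ {k a} m → a < k → (k ∸ suc a) + suc (m + suc a) ≡ suc (k + m)
[k∸suc[a]]+suc[m+suc[a]]≡suc[k+m] {k} {a} m a<k =
  ≡.trans (rearrange (k ∸ suc a) m a) (cong (λ x → suc (x + m)) (m∸n+n≡m a<k))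
  where
  rearrange : ∀ d m a → d + suc (m + suc a) ≡ suc (d + suc a + m)
  rearrange = solve-∀

module Sums {c ℓ} (R : CommutativeRing c ℓ) where
  open QCalc R
  open CommutativeRing R
    using (refl; sym; trans; reflexive; +-cong; +-congˡ; +-congʳ; +-identityˡ; +-identityʳ; +-assoc;
           zeroʳ; distribˡ; commutativeSemiring)
  open import Algebra.Solver.Ring.NaturalCoefficients.Default commutativeSemiring
    using (solve; _:=_; _:+_)

  ∑< : ℕ → (ℕ → Carrier) → Carrier
  ∑< zero    f = 0#
  ∑< (suc n) f = ∑< n f ⊕ f n

  syntax ∑< n (λ i → x) = ∑[ i < n ] x

  Σ1≡∑ : ∀ n f → Σ1 n f ≡ ∑[ i < n ] f (suc i)
  Σ1≡∑ zero    f = ≡.refl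
  Σ1≡∑ (suc n) f = cong (_⊕ f (suc n)) (Σ1≡∑ n f)

  ∑-cong : ∀ n {f g} → (∀ i → i < n → f i ≈ g i) → ∑< n f ≈ ∑< n g
  ∑-cong zero    f≈g = refl
  ∑-cong (suc n) f≈g = +-cong (∑-cong n (λ i i<n → f≈g i (ℕₚ.m<n⇒m<1+n i<n))) (f≈g n ℕₚ.≤-refl)

  ∑-zero : ∀ n {f} → (∀ i → i < n → f i ≈ 0#) → ∑< n f ≈ 0#
  ∑-zero n f≈0 = trans (∑-cong n f≈0) (∑0≈0 n)
    where
    ∑0≈0 : ∀ n → ∑[ i < n ] 0# ≈ 0#
    ∑0≈0 zero    = refl
    ∑0≈0 (suc n) = trans (+-identityʳ _) (∑0≈0 n)

  ∑-distrib-+ : ∀ n f g → ∑[ i < n ] (f i ⊕ g i) ≈ ∑< n f ⊕ ∑< n g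
  ∑-distrib-+ zero    f g = sym (+-identityˡ 0#)
  ∑-distrib-+ (suc n) f g = trans (+-congʳ (∑-distrib-+ n f g))
    (solve 4 (λ a b c d → (a :+ b) :+ (c :+ d) := (a :+ c) :+ (b :+ d)) refl _ _ _ _)

  *-distribˡ-∑ : ∀ n x f → x ⊗ ∑< n f ≈ ∑[ i < n ] (x ⊗ f i)
  *-distribˡ-∑ zero    x f = zeroʳ x
  *-distribˡ-∑ (suc n) x f = trans (distribˡ x _ _) (+-congʳ (*-distribˡ-∑ n x f))

  ∑-linear : ∀ n x f g → ∑[ i < n ] (f i ⊕ x ⊗ g i) ≈ ∑< n f ⊕ x ⊗ ∑< n g
  ∑-linear n x f g = trans (∑-distrib-+ n f (λ i → x ⊗ g i)) (+-congˡ (sym (*-distribˡ-∑ n x g)))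

  ∑-head : ∀ n f → ∑< (suc n) f ≈ f 0 ⊕ ∑[ i < n ] f (suc i)
  ∑-head zero    f = trans (+-identityˡ _) (sym (+-identityʳ _))
  ∑-head (suc n) f = trans (+-congʳ (∑-head n f)) (+-assoc _ _ _)

  ∑-only-head : ∀ n f → (∀ i → i < n → f (suc i) ≈ 0#) → ∑< (suc n) f ≈ f 0
  ∑-only-head n f tail≈0 = trans (∑-head n f) (trans (+-congˡ (∑-zero n tail≈0)) (+-identityʳ _))

  ∑-split : ∀ a b f → ∑< (a + b) f ≈ ∑< a f ⊕ ∑[ i < b ] f (a + i)
  ∑-split a zero    f = trans (reflexive (cong (λ n → ∑< n f) (ℕₚ.+-identityʳ a))) (sym (+-identityʳ _))
  ∑-split a (suc b) f = trans (reflexive (cong (λ n → ∑< n f) (ℕₚ.+-suc a b)))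
    (trans (+-congʳ (∑-split a b f)) (+-assoc _ _ _))

  ∑-comm : ∀ m n (f : ℕ → ℕ → Carrier) → ∑[ i < m ] ∑[ j < n ] f i j ≈ ∑[ j < n ] ∑[ i < m ] f i j
  ∑-comm zero    n f = sym (∑-zero n (λ _ _ → refl))
  ∑-comm (suc m) n f = trans (+-congʳ (∑-comm m n f)) (sym (∑-distrib-+ n _ _))

  Σ1-Σ1≈∑-∑ : ∀ n k (f : ℕ → ℕ → Carrier) → Σ1 n (λ i → Σ1 k (f i)) ≈ ∑[ i < n ] ∑[ j < k ] f (suc i) (suc j)
  Σ1-Σ1≈∑-∑ n k f = trans (reflexive (Σ1≡∑ n _)) (∑-cong n (λ i _ → reflexive (Σ1≡∑ k (f (suc i)))))

module QBinomials {c ℓ} (R : CommutativeRing c ℓ) (q : CommutativeRing.Carrier R) where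
  open QCalc R
  open CommutativeRing R
    using (setoid; refl; sym; trans; reflexive; +-cong; +-congˡ; +-congʳ; *-cong; *-congˡ; *-congʳ;
           +-identityˡ; +-identityʳ; *-identityˡ; *-identityʳ; zeroˡ; zeroʳ; +-assoc; *-assoc;
           distribʳ; commutativeSemiring)
  open import Relation.Binary.Reasoning.Setoid setoid
  open import Algebra.Solver.Ring.NaturalCoefficients.Default commutativeSemiring
    using (solve; _:=_; _:+_; _:*_; con)
  open Sums R
  open import Algebra.Properties.Group (CommutativeRing.+-group R) using (∙-cancelʳ; //-rightDividesʳ)

  infix 9 q^_
  q^_ : ℕ → Carrier
  q^_ = pow q

  ⟦_,_⟧ : ℕ → ℕ → Carrier
  ⟦_,_⟧ = qbin q

  q^-cong : ∀ {a b} → a ≡ b → q^ a ≈ q^ b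
  q^-cong a≡b = reflexive (cong q^_ a≡b)

  ⟦⟧-cong : ∀ {n n′ k k′} → n ≡ n′ → k ≡ k′ → ⟦ n , k ⟧ ≈ ⟦ n′ , k′ ⟧
  ⟦⟧-cong n≡n′ k≡k′ = reflexive (cong₂ ⟦_,_⟧ n≡n′ k≡k′)

  ⟦⟧-congʳ : ∀ k {n n′} → n ≡ n′ → ⟦ n , k ⟧ ≈ ⟦ n′ , k ⟧
  ⟦⟧-congʳ k n≡n′ = reflexive (cong ⟦_, k ⟧ n≡n′)

  ⟦⟧-congˡ : ∀ n {k k′} → k ≡ k′ → ⟦ n , k ⟧ ≈ ⟦ n , k′ ⟧
  ⟦⟧-congˡ n k≡k′ = reflexive (cong ⟦ n ,_⟧ k≡k′)

  q^-+ : ∀ a b → q^ (a + b) ≈ q^ a ⊗ q^ b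
  q^-+ zero    b = sym (*-identityˡ _)
  q^-+ (suc a) b = trans (*-congˡ (q^-+ a b)) (sym (*-assoc _ _ _))

  q^-exchange : ∀ a b c d → a + b ≡ c + d → q^ a ⊗ q^ b ≈ q^ c ⊗ q^ d
  q^-exchange a b c d eq = trans (sym (q^-+ a b)) (trans (q^-cong eq) (q^-+ c d))

  k>n⇒⟦n,k⟧≈0 : ∀ {n k} → n < k → ⟦ n , k ⟧ ≈ 0#
  k>n⇒⟦n,k⟧≈0 {zero}  {suc k} _         = refl
  k>n⇒⟦n,k⟧≈0 {suc n} {suc k} (s≤s n<k) = begin
    ⟦ n , k ⟧ ⊕ q^ (suc k) ⊗ ⟦ n , suc k ⟧ ≈⟨ +-cong (k>n⇒⟦n,k⟧≈0 n<k) (*-congˡ (k>n⇒⟦n,k⟧≈0 (ℕₚ.m<n⇒m<1+n n<k))) ⟩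
    0# ⊕ q^ (suc k) ⊗ 0#                   ≈⟨ trans (+-identityˡ _) (zeroʳ _) ⟩
    0#                                     ∎

  ⟦n,n⟧≈1 : ∀ n → ⟦ n , n ⟧ ≈ 1#
  ⟦n,n⟧≈1 zero    = refl
  ⟦n,n⟧≈1 (suc n) = begin
    ⟦ n , n ⟧ ⊕ q^ (suc n) ⊗ ⟦ n , suc n ⟧ ≈⟨ +-cong (⟦n,n⟧≈1 n) (*-congˡ (k>n⇒⟦n,k⟧≈0 (ℕₚ.n<1+n n))) ⟩
    1# ⊕ q^ (suc n) ⊗ 0#                   ≈⟨ trans (+-congˡ (zeroʳ _)) (+-identityʳ 1#) ⟩
    1#                                     ∎

  -- ⟦ x + y , x ⟧ is the generating function of the lattice paths in an x × y box; in these
  -- coordinates both Pascal rules hold without side conditions.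
  box : ℕ → ℕ → Carrier
  box x y = ⟦ x + y , x ⟧

  box[x,0]≈1 : ∀ x → box x 0 ≈ 1#
  box[x,0]≈1 x = trans (⟦⟧-congʳ x (ℕₚ.+-identityʳ x)) (⟦n,n⟧≈1 x)

  box-pascalˡ : ∀ x y → box (suc x) (suc y) ≈ box x (suc y) ⊕ q^ (suc x) ⊗ box (suc x) y
  box-pascalˡ x y = +-congˡ (*-congˡ (⟦⟧-congʳ (suc x) (ℕₚ.+-suc x y)))

  box-pascalʳ : ∀ x y → box (suc x) (suc y) ≈ box (suc x) y ⊕ q^ (suc y) ⊗ box x (suc y)
  box-pascalʳ zero zero =
    solve 1 (λ p → con 1 :+ p :* (con 1 :+ p :* con 0) := (con 1 :+ p :* con 0) :+ p :* con 1) refl (q^ 1)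
  box-pascalʳ zero (suc y) = begin
    1# ⊕ q^ 1 ⊗ box 1 (suc y)               ≈⟨ +-congˡ (*-congˡ (box-pascalʳ zero y)) ⟩
    1# ⊕ q^ 1 ⊗ (box 1 y ⊕ q^ (suc y) ⊗ 1#) ≈⟨ solve 3 (λ q b p → con 1 :+ (q :* con 1) :* (b :+ p :* con 1)
                                                  := (con 1 :+ (q :* con 1) :* b) :+ (q :* p) :* con 1) refl q (box 1 y) (q^ (suc y)) ⟩
    box 1 (suc y) ⊕ q^ (suc (suc y)) ⊗ 1#   ∎
  box-pascalʳ (suc x) zero = begin
    box (suc (suc x)) 1                         ≈⟨ box-pascalˡ (suc x) 0 ⟩
    box (suc x) 1 ⊕ q^ (suc (suc x)) ⊗ box (suc (suc x)) 0
      ≈⟨ +-cong (trans (box-pascalʳ x 0) (+-congʳ (box[x,0]≈1 (suc x)))) (*-congˡ (box[x,0]≈1 (suc (suc x)))) ⟩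
    (1# ⊕ q^ 1 ⊗ box x 1) ⊕ (q ⊗ q^ (suc x)) ⊗ 1#
      ≈⟨ solve 3 (λ q b p → (con 1 :+ (q :* con 1) :* b) :+ (q :* p) :* con 1
                           := con 1 :+ (q :* con 1) :* (b :+ p :* con 1)) refl q (box x 1) (q^ (suc x)) ⟩
    1# ⊕ q^ 1 ⊗ (box x 1 ⊕ q^ (suc x) ⊗ 1#)
      ≈⟨ +-cong (sym (box[x,0]≈1 (suc (suc x)))) (*-congˡ (sym (trans (box-pascalˡ x 0) (+-congˡ (*-congˡ (box[x,0]≈1 (suc x))))))) ⟩
    box (suc (suc x)) 0 ⊕ q^ 1 ⊗ box (suc x) 1 ∎
  box-pascalʳ (suc x) (suc y) = begin
    box (2+ x) (2+ y)                         ≈⟨ box-pascalˡ (suc x) (suc y) ⟩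
    box (suc x) (2+ y) ⊕ q^ (2+ x) ⊗ box (2+ x) (suc y)
      ≈⟨ +-cong (box-pascalʳ x (suc y)) (*-congˡ (box-pascalʳ (suc x) y)) ⟩
    (box (suc x) (suc y) ⊕ q^ (2+ y) ⊗ box x (2+ y)) ⊕ q^ (2+ x) ⊗ (box (2+ x) y ⊕ q^ (suc y) ⊗ box (suc x) (suc y))
      ≈⟨ solve 6 (λ q px py a b c → (a :+ (q :* py) :* b) :+ (q :* px) :* (c :+ py :* a)
                                   := (a :+ (q :* px) :* c) :+ (q :* py) :* (b :+ px :* a))
                 refl q (q^ (suc x)) (q^ (suc y)) (box (suc x) (suc y)) (box x (2+ y)) (box (2+ x) y) ⟩
    (box (suc x) (suc y) ⊕ q^ (2+ x) ⊗ box (2+ x) y) ⊕ q^ (2+ y) ⊗ (box x (2+ y) ⊕ q^ (suc x) ⊗ box (suc x) (suc y))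
      ≈⟨ +-cong (sym (box-pascalˡ (suc x) y)) (*-congˡ (sym (box-pascalˡ x (suc y)))) ⟩
    box (2+ x) (suc y) ⊕ q^ (2+ y) ⊗ box (suc x) (2+ y) ∎
    where
    2+ : ℕ → ℕ
    2+ n = suc (suc n)

  box-sym : ∀ x y → box x y ≈ box y x
  box-sym zero    y       = sym (box[x,0]≈1 y)
  box-sym (suc x) zero    = box[x,0]≈1 (suc x)
  box-sym (suc x) (suc y) = begin
    box (suc x) (suc y)                           ≈⟨ box-pascalˡ x y ⟩
    box x (suc y) ⊕ q^ (suc x) ⊗ box (suc x) y    ≈⟨ +-cong (box-sym x (suc y)) (*-congˡ (box-sym (suc x) y)) ⟩
    box (suc y) x ⊕ q^ (suc x) ⊗ box y (suc x)    ≈⟨ box-pascalʳ y x ⟨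
    box (suc y) (suc x)                           ∎

  qbin-sym : ∀ m n → ⟦ m + n , m ⟧ ≈ ⟦ m + n , n ⟧
  qbin-sym m n = trans (box-sym m n) (⟦⟧-congʳ n (ℕₚ.+-comm n m))

  x≈0⇒x⊗y≈0 : ∀ {x y} → x ≈ 0# → x ⊗ y ≈ 0#
  x≈0⇒x⊗y≈0 {y = y} x≈0 = trans (*-congʳ x≈0) (zeroˡ y)

  y≈0⇒x⊗y≈0 : ∀ {x y} → y ≈ 0# → x ⊗ y ≈ 0#
  y≈0⇒x⊗y≈0 {x = x} y≈0 = trans (*-congˡ y≈0) (zeroʳ x)

  y≈0⇒x⊗y⊗z≈0 : ∀ {x y z} → y ≈ 0# → x ⊗ y ⊗ z ≈ 0#
  y≈0⇒x⊗y⊗z≈0 y≈0 = x≈0⇒x⊗y≈0 (y≈0⇒x⊗y≈0 y≈0)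

  q-Vandermonde : ∀ b A L →
    ∑[ t < suc L ] (q^ (t * suc b) ⊗ box A t ⊗ box b (L ∸ t)) ≈ box (A + suc b) L
  q-Vandermonde b A zero = begin
    0# ⊕ 1# ⊗ box A 0 ⊗ box b 0  ≈⟨ +-identityˡ _ ⟩
    1# ⊗ box A 0 ⊗ box b 0       ≈⟨ *-cong (trans (*-identityˡ _) (box[x,0]≈1 A)) (box[x,0]≈1 b) ⟩
    1# ⊗ 1#                      ≈⟨ *-identityˡ 1# ⟩
    1#                           ≈⟨ box[x,0]≈1 (A + suc b) ⟨
    box (A + suc b) 0            ∎
  q-Vandermonde b zero (suc L) = begin
    ∑[ t < suc (suc L) ] term 0 (suc L) t                         ≈⟨ ∑-head (suc L) _ ⟩
    term 0 (suc L) 0 ⊕ ∑[ t < suc L ] term 0 (suc L) (suc t)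
      ≈⟨ +-cong (trans (*-congʳ (*-identityˡ 1#)) (*-identityˡ _)) (∑-cong (suc L) (λ t _ → weight-0 t)) ⟩
    box b (suc L) ⊕ ∑[ t < suc L ] (q^ (suc b) ⊗ term 0 L t)     ≈⟨ +-congˡ (*-distribˡ-∑ (suc L) _ _) ⟨
    box b (suc L) ⊕ q^ (suc b) ⊗ ∑[ t < suc L ] term 0 L t       ≈⟨ +-congˡ (*-congˡ (q-Vandermonde b 0 L)) ⟩
    box b (suc L) ⊕ q^ (suc b) ⊗ box (suc b) L                   ≈⟨ box-pascalˡ b L ⟨
    box (suc b) (suc L)                                          ∎
    where
    term : ℕ → ℕ → ℕ → Carrier
    term A L t = q^ (t * suc b) ⊗ box A t ⊗ box b (L ∸ t)
    weight-0 : ∀ t → term 0 (suc L) (suc t) ≈ q^ (suc b) ⊗ term 0 L t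
    weight-0 t = trans (*-congʳ (*-congʳ (q^-+ (suc b) (t * suc b))))
      (solve 4 (λ p r o g → (p :* r) :* o :* g := p :* (r :* o :* g)) refl _ _ _ _)
  q-Vandermonde b (suc A) (suc L) = begin
    ∑[ t < suc (suc L) ] term (suc A) (suc L) t ≈⟨ ∑-head (suc L) _ ⟩
    term (suc A) (suc L) 0 ⊕ ∑[ t < suc L ] term (suc A) (suc L) (suc t)
      ≈⟨ +-cong (*-congʳ (*-congˡ (trans (box[x,0]≈1 (suc A)) (sym (box[x,0]≈1 A))))) (∑-cong (suc L) (λ t _ → split t)) ⟩
    term A (suc L) 0 ⊕ ∑[ t < suc L ] (term A (suc L) (suc t) ⊕ q^ (suc A + suc b) ⊗ term (suc A) L t)
      ≈⟨ +-congˡ (∑-linear (suc L) _ _ _) ⟩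
    term A (suc L) 0 ⊕ (∑[ t < suc L ] term A (suc L) (suc t) ⊕ q^ (suc A + suc b) ⊗ ∑[ t < suc L ] term (suc A) L t)
      ≈⟨ +-assoc _ _ _ ⟨
    (term A (suc L) 0 ⊕ ∑[ t < suc L ] term A (suc L) (suc t)) ⊕ q^ (suc A + suc b) ⊗ ∑[ t < suc L ] term (suc A) L t
      ≈⟨ +-congʳ (∑-head (suc L) _) ⟨
    ∑[ t < suc (suc L) ] term A (suc L) t ⊕ q^ (suc A + suc b) ⊗ ∑[ t < suc L ] term (suc A) L t
      ≈⟨ +-cong (q-Vandermonde b A (suc L)) (*-congˡ (q-Vandermonde b (suc A) L)) ⟩
    box (A + suc b) (suc L) ⊕ q^ (suc A + suc b) ⊗ box (suc A + suc b) L
      ≈⟨ box-pascalˡ (A + suc b) L ⟨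
    box (suc A + suc b) (suc L) ∎
    where
    term : ℕ → ℕ → ℕ → Carrier
    term A L t = q^ (t * suc b) ⊗ box A t ⊗ box b (L ∸ t)
    split : ∀ t → term (suc A) (suc L) (suc t) ≈ term A (suc L) (suc t) ⊕ q^ (suc A + suc b) ⊗ term (suc A) L t
    split t = begin
      q^ (suc t * suc b) ⊗ box (suc A) (suc t) ⊗ g
        ≈⟨ *-congʳ (*-cong (q^-+ (suc b) (t * suc b)) (box-pascalˡ A t)) ⟩
      (q^ (suc b) ⊗ q^ (t * suc b)) ⊗ (box A (suc t) ⊕ q^ (suc A) ⊗ box (suc A) t) ⊗ g
        ≈⟨ solve 6 (λ pb pt x pa y g → (pb :* pt) :* (x :+ pa :* y) :* g
                                       := (pb :* pt) :* x :* g :+ (pa :* pb) :* (pt :* y :* g))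
                   refl (q^ (suc b)) (q^ (t * suc b)) (box A (suc t)) (q^ (suc A)) (box (suc A) t) g ⟩
      (q^ (suc b) ⊗ q^ (t * suc b)) ⊗ box A (suc t) ⊗ g ⊕ (q^ (suc A) ⊗ q^ (suc b)) ⊗ term (suc A) L t
        ≈⟨ +-cong (*-congʳ (*-congʳ (q^-+ (suc b) (t * suc b)))) (*-congʳ (q^-+ (suc A) (suc b))) ⟨
      term A (suc L) (suc t) ⊕ q^ (suc A + suc b) ⊗ term (suc A) L t ∎
      where
      g = box b (L ∸ t)

  q-Vandermonde′ : ∀ A b n →
    ∑[ i < n ] (q^ ((i ∸ A) * suc b) ⊗ ⟦ i , A ⟧ ⊗ box b (n ∸ suc i)) ≈ ⟦ b + n , A + suc b ⟧
  q-Vandermonde′ A b n with n ≤? A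
  ... | yes n≤A = trans (∑-zero n (λ i i<n → y≈0⇒x⊗y⊗z≈0 (k>n⇒⟦n,k⟧≈0 (ℕₚ.<-≤-trans i<n n≤A))))
                        (sym (k>n⇒⟦n,k⟧≈0 b+n<A+suc[b]))
    where
    b+n<A+suc[b] : b + n < A + suc b
    b+n<A+suc[b] = ℕₚ.≤-trans (s≤s (ℕₚ.+-monoʳ-≤ b n≤A)) (ℕₚ.≤-reflexive (ℕₚ.+-comm (suc b) A))
  ... | no n≰A with m≤n⇒∃[o]m+o≡n (≰⇒> n≰A)
  ... | L , ≡.refl = begin
    ∑< (suc A + L) f                             ≈⟨ reflexive (cong (λ n → ∑< n f) (ℕₚ.+-suc A L)) ⟨
    ∑< (A + suc L) f                             ≈⟨ ∑-split A (suc L) f ⟩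
    ∑< A f ⊕ ∑[ t < suc L ] f (A + t)
      ≈⟨ +-cong (∑-zero A (λ i i<A → y≈0⇒x⊗y⊗z≈0 (k>n⇒⟦n,k⟧≈0 i<A))) (∑-cong (suc L) (λ t _ → shift-by-A t)) ⟩
    0# ⊕ ∑[ t < suc L ] (q^ (t * suc b) ⊗ box A t ⊗ box b (L ∸ t)) ≈⟨ +-identityˡ _ ⟩
    ∑[ t < suc L ] (q^ (t * suc b) ⊗ box A t ⊗ box b (L ∸ t))      ≈⟨ q-Vandermonde b A L ⟩
    box (A + suc b) L                            ≈⟨ ⟦⟧-congʳ (A + suc b) index ⟩
    ⟦ b + (suc A + L) , A + suc b ⟧              ∎
    where
    index : A + suc b + L ≡ b + (suc A + L)
    index = solveℕ (A ∷ b ∷ L ∷ [])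
    f : ℕ → Carrier
    f i = q^ ((i ∸ A) * suc b) ⊗ ⟦ i , A ⟧ ⊗ box b (suc A + L ∸ suc i)
    shift-by-A : ∀ t → f (A + t) ≈ q^ (t * suc b) ⊗ box A t ⊗ box b (L ∸ t)
    shift-by-A t = *-cong (*-congʳ (q^-cong (cong (_* suc b) (m+n∸m≡n A t))))
                          (⟦⟧-congʳ b (cong (λ x → b + x) ([m+n]∸[m+o]≡n∸o A L t)))

  absorption : ∀ X k → ⟦ X , k ⟧ ⊗ ⟦ suc X , 1 ⟧ ≈ ⟦ suc k , 1 ⟧ ⊗ ⟦ suc X , suc k ⟧
  absorption X       zero    = *-congʳ (sym (⟦n,n⟧≈1 1))
  absorption zero    (suc k) = trans (zeroˡ _) (sym (y≈0⇒x⊗y≈0 (k>n⇒⟦n,k⟧≈0 {1} {suc (suc k)} (s≤s (s≤s z≤n)))))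
  absorption (suc X) (suc k) = begin
    (x ⊕ p ⊗ y) ⊗ (1# ⊕ q^ 1 ⊗ z)
      ≈⟨ solve 5 (λ q x p y z → (x :+ p :* y) :* (con 1 :+ (q :* con 1) :* z)
                               := x :+ (q :* con 1) :* (x :* z) :+ p :* y :+ p :* (q :* con 1) :* (y :* z)) refl q x p y z ⟩
    x ⊕ q^ 1 ⊗ (x ⊗ z) ⊕ p ⊗ y ⊕ p ⊗ q^ 1 ⊗ (y ⊗ z)
      ≈⟨ +-cong (+-congʳ (+-congˡ (*-congˡ (absorption X k)))) (*-congˡ (absorption X (suc k))) ⟩
    x ⊕ q^ 1 ⊗ (w ⊗ (x ⊕ p ⊗ y)) ⊕ p ⊗ y ⊕ p ⊗ q^ 1 ⊗ ((1# ⊕ q^ 1 ⊗ w) ⊗ y′)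
      ≈⟨ solve 6 (λ q x p y w y′ →
             x :+ (q :* con 1) :* (w :* (x :+ p :* y)) :+ p :* y :+ p :* (q :* con 1) :* ((con 1 :+ (q :* con 1) :* w) :* y′)
             := (con 1 :+ (q :* con 1) :* w) :* ((x :+ p :* y) :+ (q :* p) :* y′)) refl q x p y w y′ ⟩
    (1# ⊕ q^ 1 ⊗ w) ⊗ ((x ⊕ p ⊗ y) ⊕ q^ (suc (suc k)) ⊗ y′) ∎
    where
    x = ⟦ X , k ⟧
    y = ⟦ X , suc k ⟧
    z = ⟦ suc X , 1 ⟧
    w = ⟦ suc k , 1 ⟧
    y′ = ⟦ suc X , suc (suc k) ⟧
    p = q^ (suc k)

  coeff : ℕ → ℕ → ℕ → Carrier
  coeff k m a = q^ ((k ∸ a) * (m ∸ a)) ⊗ ⟦ m , a ⟧ ⊗ ⟦ suc k , suc a ⟧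

  k<a⇒coeff≈0 : ∀ {k m a} → k < a → coeff k m a ≈ 0#
  k<a⇒coeff≈0 k<a = y≈0⇒x⊗y≈0 (k>n⇒⟦n,k⟧≈0 (s≤s k<a))

  m<a⇒coeff≈0 : ∀ {k m a} → m < a → coeff k m a ≈ 0#
  m<a⇒coeff≈0 m<a = y≈0⇒x⊗y⊗z≈0 (k>n⇒⟦n,k⟧≈0 m<a)

  coeff-diag : ∀ k m → coeff k m k ≈ ⟦ m , k ⟧
  coeff-diag k m = begin
    q^ ((k ∸ k) * (m ∸ k)) ⊗ ⟦ m , k ⟧ ⊗ ⟦ suc k , suc k ⟧
      ≈⟨ *-cong (*-congʳ (q^-cong (cong (_* (m ∸ k)) (n∸n≡0 k)))) (⟦n,n⟧≈1 (suc k)) ⟩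
    1# ⊗ ⟦ m , k ⟧ ⊗ 1#  ≈⟨ trans (*-identityʳ _) (*-identityˡ _) ⟩
    ⟦ m , k ⟧            ∎

  shift : (ℕ → Carrier) → ℕ → Carrier
  shift f zero    = 0#
  shift f (suc a) = f a

  private
    *-congʳ-on-0 : ∀ {x y w} → w ≈ 0# → x ⊗ w ≈ y ⊗ w
    *-congʳ-on-0 w≈0 = trans (y≈0⇒x⊗y≈0 w≈0) (sym (y≈0⇒x⊗y≈0 w≈0))

    q^-exchange₃ : ∀ a b c d e → a + b ≡ c + d + e → q^ a ⊗ q^ b ≈ q^ c ⊗ q^ d ⊗ q^ e
    q^-exchange₃ a b c d e eq = trans (q^-exchange a b (c + d) e eq) (*-congʳ (q^-+ c d))

  -- For a = suc a′, Pascal's rule gives ⟦ m+1 , a ⟧ = E + q^a D and ⟦ k+2 , a+1 ⟧ = F + q^(a+1) G with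
  -- E = ⟦ m , a′ ⟧, D = ⟦ m , a ⟧, F = ⟦ k+1 , a ⟧, G = ⟦ k+1 , a+1 ⟧. Then monomial-DG, monomial-EDG and
  -- monomial-DF match the powers of q in front of D G, (E + q^a D) G and D (F + q^(a+1) G); the exponents
  -- only agree where that product does not vanish, hence the side conditions of the exponent identities.
  exponent-DG : ∀ {k m a} → a < k → a < m →
    suc k + suc m + (k ∸ suc a) * (m ∸ suc a) ≡ (k ∸ a) * (m ∸ a) + suc a + suc (suc a)
  exponent-DG {a = a} a<k a<m with m≤n⇒∃[o]m+o≡n a<k | m≤n⇒∃[o]m+o≡n a<m
  ... | u , ≡.refl | v , ≡.refl
    rewrite m+n∸m≡n a u | m+n∸m≡n a v | suc[m+n]∸m≡suc[n] a u | suc[m+n]∸m≡suc[n] a v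
    = solveℕ (a ∷ u ∷ v ∷ [])

  exponent-EDG : ∀ {k m a} → a < k → a ≤ m →
    suc (suc m) + (k ∸ suc a) * (m ∸ a) ≡ (k ∸ a) * (m ∸ a) + suc (suc a)
  exponent-EDG {a = a} a<k a≤m with m≤n⇒∃[o]m+o≡n a<k | m≤n⇒∃[o]m+o≡n a≤m
  ... | u , ≡.refl | v , ≡.refl
    rewrite m+n∸m≡n a u | m+n∸m≡n a v | suc[m+n]∸m≡suc[n] a u
    = solveℕ (a ∷ u ∷ v ∷ [])

  exponent-DF : ∀ {k m a} → a ≤ k → a < m →
    suc k + (k ∸ a) * (m ∸ suc a) ≡ (k ∸ a) * (m ∸ a) + suc a
  exponent-DF {a = a} a≤k a<m with m≤n⇒∃[o]m+o≡n a≤k | m≤n⇒∃[o]m+o≡n a<m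
  ... | u , ≡.refl | v , ≡.refl
    rewrite m+n∸m≡n a u | m+n∸m≡n a v | suc[m+n]∸m≡suc[n] a v
    = solveℕ (a ∷ u ∷ v ∷ [])

  monomial-DG : ∀ k m a →
    (q^ (suc k + suc m) ⊗ q^ ((k ∸ suc a) * (m ∸ suc a))) ⊗ (⟦ m , suc a ⟧ ⊗ ⟦ suc k , suc (suc a) ⟧)
      ≈ (q^ ((k ∸ a) * (m ∸ a)) ⊗ q^ (suc a) ⊗ q^ (suc (suc a))) ⊗ (⟦ m , suc a ⟧ ⊗ ⟦ suc k , suc (suc a) ⟧)
  monomial-DG k m a with a <? k | a <? m
  ... | yes a<k | yes a<m = *-congʳ (q^-exchange₃ (suc k + suc m) ((k ∸ suc a) * (m ∸ suc a))
                                                   ((k ∸ a) * (m ∸ a)) (suc a) (suc (suc a)) (exponent-DG a<k a<m))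
  ... | no a≮k  | _       = *-congʳ-on-0 (y≈0⇒x⊗y≈0 (k>n⇒⟦n,k⟧≈0 {suc k} {suc (suc a)} (s≤s (s≤s (ℕₚ.≮⇒≥ a≮k)))))
  ... | yes _   | no a≮m  = *-congʳ-on-0 (x≈0⇒x⊗y≈0 (k>n⇒⟦n,k⟧≈0 {m} {suc a} (s≤s (ℕₚ.≮⇒≥ a≮m))))

  monomial-EDG : ∀ k m a →
    (q^ (suc (suc m)) ⊗ q^ ((k ∸ suc a) * (m ∸ a))) ⊗ (⟦ suc m , suc a ⟧ ⊗ ⟦ suc k , suc (suc a) ⟧)
      ≈ (q^ ((k ∸ a) * (m ∸ a)) ⊗ q^ (suc (suc a))) ⊗ (⟦ suc m , suc a ⟧ ⊗ ⟦ suc k , suc (suc a) ⟧)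
  monomial-EDG k m a with a <? k | a ≤? m
  ... | yes a<k | yes a≤m = *-congʳ (q^-exchange (suc (suc m)) ((k ∸ suc a) * (m ∸ a))
                                                 ((k ∸ a) * (m ∸ a)) (suc (suc a)) (exponent-EDG a<k a≤m))
  ... | no a≮k  | _       = *-congʳ-on-0 (y≈0⇒x⊗y≈0 (k>n⇒⟦n,k⟧≈0 {suc k} {suc (suc a)} (s≤s (s≤s (ℕₚ.≮⇒≥ a≮k)))))
  ... | yes _   | no a≰m  = *-congʳ-on-0 (x≈0⇒x⊗y≈0 (k>n⇒⟦n,k⟧≈0 {suc m} {suc a} (s≤s (≰⇒> a≰m))))

  monomial-DF : ∀ k m a →
    (q^ (suc k) ⊗ q^ ((k ∸ a) * (m ∸ suc a))) ⊗ (⟦ m , suc a ⟧ ⊗ ⟦ suc (suc k) , suc (suc a) ⟧)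
      ≈ (q^ ((k ∸ a) * (m ∸ a)) ⊗ q^ (suc a)) ⊗ (⟦ m , suc a ⟧ ⊗ ⟦ suc (suc k) , suc (suc a) ⟧)
  monomial-DF k m a with a ≤? k | a <? m
  ... | yes a≤k | yes a<m = *-congʳ (q^-exchange (suc k) ((k ∸ a) * (m ∸ suc a))
                                                 ((k ∸ a) * (m ∸ a)) (suc a) (exponent-DF a≤k a<m))
  ... | no a≰k  | _       = *-congʳ-on-0 (y≈0⇒x⊗y≈0 (k>n⇒⟦n,k⟧≈0 {suc (suc k)} {suc (suc a)} (s≤s (s≤s (≰⇒> a≰k)))))
  ... | yes _   | no a≮m  = *-congʳ-on-0 (x≈0⇒x⊗y≈0 (k>n⇒⟦n,k⟧≈0 {m} {suc a} (s≤s (ℕₚ.≮⇒≥ a≮m))))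

  private
    recurrence-identity : ∀ {ε x y z e₁ e₂ e₃ Qa Qa1 E D F G} →
      (x ⊗ e₁) ⊗ (D ⊗ G) ≈ (ε ⊗ Qa ⊗ Qa1) ⊗ (D ⊗ G) →
      (y ⊗ e₂) ⊗ ((E ⊕ Qa ⊗ D) ⊗ G) ≈ (ε ⊗ Qa1) ⊗ ((E ⊕ Qa ⊗ D) ⊗ G) →
      (z ⊗ e₃) ⊗ (D ⊗ (F ⊕ Qa1 ⊗ G)) ≈ (ε ⊗ Qa) ⊗ (D ⊗ (F ⊕ Qa1 ⊗ G)) →
      ε ⊗ (E ⊕ Qa ⊗ D) ⊗ (F ⊕ Qa1 ⊗ G) ⊕ x ⊗ (e₁ ⊗ D ⊗ G)
        ≈ (ε ⊗ E ⊗ F ⊕ y ⊗ (e₂ ⊗ (E ⊕ Qa ⊗ D) ⊗ G)) ⊕ z ⊗ (e₃ ⊗ D ⊗ (F ⊕ Qa1 ⊗ G))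
    recurrence-identity {ε} {x} {y} {z} {e₁} {e₂} {e₃} {Qa} {Qa1} {E} {D} {F} {G} DG EDG DF = begin
      ε ⊗ (E ⊕ Qa ⊗ D) ⊗ (F ⊕ Qa1 ⊗ G) ⊕ x ⊗ (e₁ ⊗ D ⊗ G)
        ≈⟨ +-congˡ (trans (reassoc x e₁ D G) DG) ⟩
      ε ⊗ (E ⊕ Qa ⊗ D) ⊗ (F ⊕ Qa1 ⊗ G) ⊕ (ε ⊗ Qa ⊗ Qa1) ⊗ (D ⊗ G)
        ≈⟨ solve 7 (λ ε Qa Qa1 E D F G →
             ε :* (E :+ Qa :* D) :* (F :+ Qa1 :* G) :+ (ε :* Qa :* Qa1) :* (D :* G)
             := (ε :* E :* F :+ (ε :* Qa1) :* ((E :+ Qa :* D) :* G)) :+ (ε :* Qa) :* (D :* (F :+ Qa1 :* G)))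
             refl ε Qa Qa1 E D F G ⟩
      (ε ⊗ E ⊗ F ⊕ (ε ⊗ Qa1) ⊗ ((E ⊕ Qa ⊗ D) ⊗ G)) ⊕ (ε ⊗ Qa) ⊗ (D ⊗ (F ⊕ Qa1 ⊗ G))
        ≈⟨ +-cong (+-congˡ (trans (reassoc y e₂ _ G) EDG)) (trans (reassoc z e₃ D _) DF) ⟨
      (ε ⊗ E ⊗ F ⊕ y ⊗ (e₂ ⊗ (E ⊕ Qa ⊗ D) ⊗ G)) ⊕ z ⊗ (e₃ ⊗ D ⊗ (F ⊕ Qa1 ⊗ G)) ∎
      where
      reassoc : ∀ a b c d → a ⊗ (b ⊗ c ⊗ d) ≈ (a ⊗ b) ⊗ (c ⊗ d)
      reassoc = solve 4 (λ a b c d → a :* (b :* c :* d) := (a :* b) :* (c :* d)) refl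

  coeff-recurrence : ∀ k m a →
    coeff (suc k) (suc m) a ⊕ q^ (suc k + suc m) ⊗ coeff k m a
      ≈ (shift (coeff k m) a ⊕ q^ (suc (suc m)) ⊗ coeff k (suc m) a) ⊕ q^ (suc k) ⊗ coeff (suc k) m a
  coeff-recurrence k m zero = begin
    q^ (suc k * suc m) ⊗ 1# ⊗ X₁ ⊕ q^ (suc k + suc m) ⊗ (q^ (k * m) ⊗ 1# ⊗ X₀)
      ≈⟨ +-congʳ (*-congʳ (*-congʳ (trans (q^-cong (ℕₚ.*-suc (suc k) m)) (q^-+ (suc k) (suc k * m))))) ⟩
    (q^ (suc k) ⊗ q^ (suc k * m)) ⊗ 1# ⊗ X₁ ⊕ q^ (suc k + suc m) ⊗ (q^ (k * m) ⊗ 1# ⊗ X₀)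
      ≈⟨ +-congˡ (trans (solve 4 (λ a b o x → a :* (b :* o :* x) := (a :* b) :* o :* x) refl _ _ _ _)
                        (*-congʳ (*-congʳ (q^-exchange (suc k + suc m) (k * m) (suc (suc m)) (k * suc m)
                                                       (solveℕ (k ∷ m ∷ [])))))) ⟩
    (q^ (suc k) ⊗ q^ (suc k * m)) ⊗ 1# ⊗ X₁ ⊕ (q^ (suc (suc m)) ⊗ q^ (k * suc m)) ⊗ 1# ⊗ X₀
      ≈⟨ solve 7 (λ a b c d o x y → (a :* b) :* o :* x :+ (c :* d) :* o :* y
                                   := (con 0 :+ c :* (d :* o :* y)) :+ a :* (b :* o :* x)) refl _ _ _ _ _ _ _ ⟩
    (0# ⊕ q^ (suc (suc m)) ⊗ (q^ (k * suc m) ⊗ 1# ⊗ X₀)) ⊕ q^ (suc k) ⊗ (q^ (suc k * m) ⊗ 1# ⊗ X₁) ∎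
    where
    X₀ = ⟦ suc k , 1 ⟧
    X₁ = ⟦ suc (suc k) , 1 ⟧
  coeff-recurrence k m (suc a) =
    recurrence-identity (monomial-DG k m a) (monomial-EDG k m a) (monomial-DF k m a)

  -- After shifting a, Pascal's rule ⟦ X+2+a , K+1 ⟧ = ⟦ X+1+a , K ⟧ + q^(K+1) ⟦ X+1+a , K+1 ⟧.
  summation-by-parts : ∀ X K N (c : ℕ → Carrier) → c N ≈ 0# →
    ∑[ a < suc N ] (shift c a ⊗ ⟦ suc X + a , suc K ⟧)
      ≈ ∑[ a < suc N ] (c a ⊗ ⟦ suc X + a , K ⟧) ⊕ q^ (suc K) ⊗ ∑[ a < suc N ] (c a ⊗ ⟦ suc X + a , suc K ⟧)
  summation-by-parts X K N c cN≈0 = begin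
    ∑[ a < suc N ] (shift c a ⊗ ⟦ suc X + a , suc K ⟧)
      ≈⟨ ∑-head N _ ⟩
    0# ⊗ ⟦ suc X + 0 , suc K ⟧ ⊕ ∑[ a < N ] (c a ⊗ ⟦ suc X + suc a , suc K ⟧)
      ≈⟨ trans (+-congʳ (zeroˡ _)) (+-identityˡ _) ⟩
    ∑[ a < N ] (c a ⊗ ⟦ suc X + suc a , suc K ⟧)
      ≈⟨ trans (+-congˡ (x≈0⇒x⊗y≈0 cN≈0)) (+-identityʳ _) ⟨
    ∑[ a < suc N ] (c a ⊗ ⟦ suc X + suc a , suc K ⟧)
      ≈⟨ ∑-cong (suc N) (λ a _ → pascal a) ⟩
    ∑[ a < suc N ] (c a ⊗ ⟦ suc X + a , K ⟧ ⊕ q^ (suc K) ⊗ (c a ⊗ ⟦ suc X + a , suc K ⟧))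
      ≈⟨ ∑-linear (suc N) _ _ _ ⟩
    ∑[ a < suc N ] (c a ⊗ ⟦ suc X + a , K ⟧) ⊕ q^ (suc K) ⊗ ∑[ a < suc N ] (c a ⊗ ⟦ suc X + a , suc K ⟧) ∎
    where
    pascal : ∀ a → c a ⊗ ⟦ suc X + suc a , suc K ⟧ ≈ c a ⊗ ⟦ suc X + a , K ⟧ ⊕ q^ (suc K) ⊗ (c a ⊗ ⟦ suc X + a , suc K ⟧)
    pascal a = trans (*-congˡ (⟦⟧-congʳ (suc K) (ℕₚ.+-suc (suc X) a)))
      (solve 4 (λ c u p t → c :* (u :+ p :* t) := c :* u :+ p :* (c :* t)) refl (c a) _ _ _)

  product-sum : ℕ → ℕ → ℕ → ℕ → Carrier
  product-sum X k m N = ∑[ a < suc N ] (coeff k m a ⊗ ⟦ suc X + a , suc (k + m) ⟧)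

  -- The coefficient recurrence summed against ⟦ X+1+a , k+m+2 ⟧; summation by parts undoes the shift,
  -- and the extra multiple of the sum for (k, m) it produces cancels.
  product-sum-step : ∀ X k m N → k < N →
    ∑[ a < suc N ] (coeff (suc k) (suc m) a ⊗ ⟦ suc X + a , suc k + suc m ⟧)
      ≈ (product-sum X k m N ⊕ q^ (suc (suc m)) ⊗ product-sum X k (suc m) N) ⊕ q^ (suc k) ⊗ product-sum X (suc k) m N
  product-sum-step X k m N k<N = ∙-cancelʳ Z _ _ (begin
    ∑[ a < suc N ] (coeff (suc k) (suc m) a ⊗ U a) ⊕ Z
      ≈⟨ ∑-linear (suc N) _ _ _ ⟨
    ∑[ a < suc N ] (coeff (suc k) (suc m) a ⊗ U a ⊕ q^ (suc k + suc m) ⊗ (coeff k m a ⊗ U a))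
      ≈⟨ ∑-cong (suc N) (λ a _ → recurrence a) ⟩
    ∑[ a < suc N ] ((shift (coeff k m) a ⊗ U a ⊕ q^ (suc (suc m)) ⊗ (coeff k (suc m) a ⊗ U a))
                     ⊕ q^ (suc k) ⊗ (coeff (suc k) m a ⊗ U a))
      ≈⟨ trans (∑-linear (suc N) _ _ _) (+-congʳ (∑-linear (suc N) _ _ _)) ⟩
    (∑[ a < suc N ] (shift (coeff k m) a ⊗ U a) ⊕ q^ (suc (suc m)) ⊗ product-sum X k (suc m) N)
      ⊕ q^ (suc k) ⊗ ∑[ a < suc N ] (coeff (suc k) m a ⊗ U a)
      ≈⟨ +-cong (+-congʳ (summation-by-parts X (k + suc m) N (coeff k m) (k<a⇒coeff≈0 k<N)))
                (*-congˡ (∑-cong (suc N) (λ a _ → *-congˡ (⟦⟧-congˡ (suc X + a) (cong suc (ℕₚ.+-suc k m)))))) ⟩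
    ((∑[ a < suc N ] (coeff k m a ⊗ ⟦ suc X + a , k + suc m ⟧) ⊕ Z) ⊕ q^ (suc (suc m)) ⊗ product-sum X k (suc m) N)
      ⊕ q^ (suc k) ⊗ product-sum X (suc k) m N
      ≈⟨ +-congʳ (+-congʳ (+-congʳ (∑-cong (suc N) (λ a _ → *-congˡ (⟦⟧-congˡ (suc X + a) (ℕₚ.+-suc k m)))))) ⟩
    ((product-sum X k m N ⊕ Z) ⊕ q^ (suc (suc m)) ⊗ product-sum X k (suc m) N) ⊕ q^ (suc k) ⊗ product-sum X (suc k) m N
      ≈⟨ solve 4 (λ s z t u → ((s :+ z) :+ t) :+ u := ((s :+ t) :+ u) :+ z) refl _ Z _ _ ⟩
    ((product-sum X k m N ⊕ q^ (suc (suc m)) ⊗ product-sum X k (suc m) N) ⊕ q^ (suc k) ⊗ product-sum X (suc k) m N) ⊕ Z ∎)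
    where
    U : ℕ → Carrier
    U a = ⟦ suc X + a , suc k + suc m ⟧
    Z = q^ (suc k + suc m) ⊗ ∑[ a < suc N ] (coeff k m a ⊗ U a)
    recurrence : ∀ a → coeff (suc k) (suc m) a ⊗ U a ⊕ q^ (suc k + suc m) ⊗ (coeff k m a ⊗ U a)
      ≈ (shift (coeff k m) a ⊗ U a ⊕ q^ (suc (suc m)) ⊗ (coeff k (suc m) a ⊗ U a)) ⊕ q^ (suc k) ⊗ (coeff (suc k) m a ⊗ U a)
    recurrence a = begin
      coeff (suc k) (suc m) a ⊗ U a ⊕ q^ (suc k + suc m) ⊗ (coeff k m a ⊗ U a)
        ≈⟨ trans (+-congˡ (sym (*-assoc _ _ _))) (sym (distribʳ _ _ _)) ⟩
      (coeff (suc k) (suc m) a ⊕ q^ (suc k + suc m) ⊗ coeff k m a) ⊗ U a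
        ≈⟨ *-congʳ (coeff-recurrence k m a) ⟩
      ((shift (coeff k m) a ⊕ q^ (suc (suc m)) ⊗ coeff k (suc m) a) ⊕ q^ (suc k) ⊗ coeff (suc k) m a) ⊗ U a
        ≈⟨ solve 6 (λ s p x r y u → ((s :+ p :* x) :+ r :* y) :* u := (s :* u :+ p :* (x :* u)) :+ r :* (y :* u))
                   refl _ _ _ _ _ _ ⟩
      (shift (coeff k m) a ⊗ U a ⊕ q^ (suc (suc m)) ⊗ (coeff k (suc m) a ⊗ U a)) ⊕ q^ (suc k) ⊗ (coeff (suc k) m a ⊗ U a) ∎

  product-formula : ∀ X k m N → k ≤ N → ⟦ X , k ⟧ ⊗ ⟦ suc X , suc m ⟧ ≈ product-sum X k m N
  product-formula X zero m N _ = begin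
    1# ⊗ ⟦ suc X , suc m ⟧               ≈⟨ *-cong coeff≈1 (⟦⟧-congʳ (suc m) (cong suc (ℕₚ.+-identityʳ X))) ⟨
    coeff 0 m 0 ⊗ ⟦ suc X + 0 , suc m ⟧  ≈⟨ ∑-only-head N _ (λ a _ → x≈0⇒x⊗y≈0 (k<a⇒coeff≈0 {m = m} (s≤s z≤n))) ⟨
    product-sum X 0 m N                  ∎
    where
    coeff≈1 : coeff 0 m 0 ≈ 1#
    coeff≈1 = trans (*-cong (*-identityˡ 1#) (⟦n,n⟧≈1 1)) (*-identityˡ 1#)
  product-formula X (suc k) zero N _ = begin
    ⟦ X , suc k ⟧ ⊗ ⟦ suc X , 1 ⟧                         ≈⟨ absorption X (suc k) ⟩
    ⟦ suc (suc k) , 1 ⟧ ⊗ ⟦ suc X , suc (suc k) ⟧         ≈⟨ *-cong coeff≈ (⟦⟧-cong (+0 (suc X)) (+0 (suc (suc k)))) ⟨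
    coeff (suc k) 0 0 ⊗ ⟦ suc X + 0 , suc (suc k + 0) ⟧
      ≈⟨ ∑-only-head N _ (λ a _ → x≈0⇒x⊗y≈0 (m<a⇒coeff≈0 {k = suc k} (s≤s z≤n))) ⟨
    product-sum X (suc k) 0 N                             ∎
    where
    +0 = ℕₚ.+-identityʳ
    coeff≈ : coeff (suc k) 0 0 ≈ ⟦ suc (suc k) , 1 ⟧
    coeff≈ = trans (*-congʳ (trans (*-congʳ (q^-cong (ℕₚ.*-zeroʳ (suc k)))) (*-identityˡ 1#))) (*-identityˡ _)
  product-formula zero (suc k) (suc m) N _ = trans (zeroˡ _) (sym (∑-zero (suc N) vanishes))
    where
    vanishes : ∀ a → a < suc N → coeff (suc k) (suc m) a ⊗ ⟦ suc a , suc (suc k + suc m) ⟧ ≈ 0#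
    vanishes a _ with a ≤? suc m
    ... | yes a≤m = y≈0⇒x⊗y≈0 (k>n⇒⟦n,k⟧≈0 (s≤s (s≤s (ℕₚ.≤-trans a≤m (ℕₚ.m≤n+m (suc m) k)))))
    ... | no a≰m  = x≈0⇒x⊗y≈0 (m<a⇒coeff≈0 (≰⇒> a≰m))
  product-formula (suc X) (suc k) (suc m) N k<N = begin
    (⟦ X , k ⟧ ⊕ q^ (suc k) ⊗ ⟦ X , suc k ⟧) ⊗ (⟦ suc X , suc m ⟧ ⊕ q^ (suc (suc m)) ⊗ ⟦ suc X , suc (suc m) ⟧)
      ≈⟨ solve 6 (λ a p b c r d → (a :+ p :* b) :* (c :+ r :* d)
                                 := ((a :* c :+ r :* (a :* d)) :+ p :* (b :* c)) :+ (p :* r) :* (b :* d)) refl _ _ _ _ _ _ ⟩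
    ((⟦ X , k ⟧ ⊗ ⟦ suc X , suc m ⟧ ⊕ q^ (suc (suc m)) ⊗ (⟦ X , k ⟧ ⊗ ⟦ suc X , suc (suc m) ⟧))
      ⊕ q^ (suc k) ⊗ (⟦ X , suc k ⟧ ⊗ ⟦ suc X , suc m ⟧)) ⊕ (q^ (suc k) ⊗ q^ (suc (suc m))) ⊗ (⟦ X , suc k ⟧ ⊗ ⟦ suc X , suc (suc m) ⟧)
      ≈⟨ +-cong (+-cong (+-cong (product-formula X k m N k≤N) (*-congˡ (product-formula X k (suc m) N k≤N)))
                        (*-congˡ (product-formula X (suc k) m N k<N)))
                (*-cong (trans (sym (q^-+ (suc k) (suc (suc m)))) (q^-cong (ℕₚ.+-suc (suc k) (suc m))))
                        (product-formula X (suc k) (suc m) N k<N)) ⟩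
    ((product-sum X k m N ⊕ q^ (suc (suc m)) ⊗ product-sum X k (suc m) N) ⊕ q^ (suc k) ⊗ product-sum X (suc k) m N)
      ⊕ q^ (suc (suc k + suc m)) ⊗ product-sum X (suc k) (suc m) N
      ≈⟨ +-congʳ (product-sum-step X k m N k<N) ⟨
    ∑[ a < suc N ] (coeff (suc k) (suc m) a ⊗ ⟦ suc X + a , suc k + suc m ⟧)
      ⊕ q^ (suc (suc k + suc m)) ⊗ product-sum X (suc k) (suc m) N
      ≈⟨ ∑-linear (suc N) _ _ _ ⟨
    ∑[ a < suc N ] (coeff (suc k) (suc m) a ⊗ ⟦ suc X + a , suc k + suc m ⟧
                     ⊕ q^ (suc (suc k + suc m)) ⊗ (coeff (suc k) (suc m) a ⊗ ⟦ suc X + a , suc (suc k + suc m) ⟧))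
      ≈⟨ ∑-cong (suc N) (λ a _ → solve 4 (λ c u p t → c :* (u :+ p :* t) := c :* u :+ p :* (c :* t)) refl _ _ _ _) ⟨
    product-sum (suc X) (suc k) (suc m) N ∎
    where
    k≤N = ℕₚ.<⇒≤ k<N

  difference-as-sum : ∀ m n k →
    (⟦ m + n , k ⟧ ⊗ ⟦ m + n + 1 , n ⟧) ⊖ (⟦ m , k ⟧ ⊗ ⟦ k + m + n + 1 , n ⟧)
      ≈ ∑[ a < k ] (coeff k m a ⊗ ⟦ suc (m + n) + a , suc (k + m) ⟧)
  difference-as-sum m n k = begin
    (⟦ m + n , k ⟧ ⊗ ⟦ m + n + 1 , n ⟧) ⊖ (⟦ m , k ⟧ ⊗ ⟦ k + m + n + 1 , n ⟧)
      ≈⟨ +-cong (*-congˡ first) (-‿cong (*-cong (sym (coeff-diag k m)) second)) ⟩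
    (⟦ m + n , k ⟧ ⊗ ⟦ suc (m + n) , suc m ⟧) ⊖ last
      ≈⟨ +-congʳ (product-formula (m + n) k m k ℕₚ.≤-refl) ⟩
    (∑[ a < k ] (coeff k m a ⊗ ⟦ suc (m + n) + a , suc (k + m) ⟧) ⊕ last) ⊖ last
      ≈⟨ //-rightDividesʳ last _ ⟩
    ∑[ a < k ] (coeff k m a ⊗ ⟦ suc (m + n) + a , suc (k + m) ⟧) ∎
    where
    open CommutativeRing R using (-‿cong)
    last = coeff k m k ⊗ ⟦ suc (m + n) + k , suc (k + m) ⟧
    first : ⟦ m + n + 1 , n ⟧ ≈ ⟦ suc (m + n) , suc m ⟧
    first = trans (⟦⟧-congʳ n (ℕₚ.+-comm (m + n) 1)) (sym (qbin-sym (suc m) n))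
    second : ⟦ k + m + n + 1 , n ⟧ ≈ ⟦ suc (m + n) + k , suc (k + m) ⟧
    second = trans (⟦⟧-congʳ n (ℕₚ.+-comm (k + m + n) 1))
      (trans (sym (qbin-sym (suc (k + m)) n))
             (⟦⟧-congʳ (suc (k + m)) (cong suc (≡.trans (ℕₚ.+-assoc k m n) (ℕₚ.+-comm k (m + n))))))

  summand : Carrier → ℕ → ℕ → ℕ → ℕ → ℕ → Carrier
  summand qinv m n k i j =
    zpow q qinv (expo m k i j) ⊗ ⟦ m , j ∸ 1 ⟧ ⊗ ⟦ k + 1 , j ⟧ ⊗ ⟦ i ∸ 1 , k ∸ j ⟧ ⊗ ⟦ m + n + j ∸ i , n ∸ i ⟧

  zpow-factorization : ∀ qinv m k a i y → a < k →
    zpow q qinv (expo m k (suc i) (suc a)) ⊗ ⟦ m , a ⟧ ⊗ ⟦ k + 1 , suc a ⟧ ⊗ ⟦ i , k ∸ suc a ⟧ ⊗ y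
      ≈ coeff k m a ⊗ (q^ ((i ∸ (k ∸ suc a)) * suc (m + suc a)) ⊗ ⟦ i , k ∸ suc a ⟧ ⊗ y)
  zpow-factorization qinv m k a i y a<k with a ≤? m | k ∸ suc a ≤? i
  ... | no a≰m | _ = trans (x≈0⇒x⊗y≈0 (x≈0⇒x⊗y≈0 (y≈0⇒x⊗y⊗z≈0 ⟦m,a⟧≈0)))
                           (sym (x≈0⇒x⊗y≈0 (m<a⇒coeff≈0 {k} (≰⇒> a≰m))))
    where ⟦m,a⟧≈0 = k>n⇒⟦n,k⟧≈0 (≰⇒> a≰m)
  ... | yes _ | no A≰i = trans (y≈0⇒x⊗y⊗z≈0 ⟦i,A⟧≈0) (sym (y≈0⇒x⊗y≈0 (y≈0⇒x⊗y⊗z≈0 ⟦i,A⟧≈0)))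
    where ⟦i,A⟧≈0 = k>n⇒⟦n,k⟧≈0 (≰⇒> A≰i)
  ... | yes a≤m | yes A≤i = begin
    zpow q qinv (expo m k (suc i) (suc a)) ⊗ ⟦ m , a ⟧ ⊗ ⟦ k + 1 , suc a ⟧ ⊗ ⟦ i , k ∸ suc a ⟧ ⊗ y
      ≈⟨ *-congʳ (*-congʳ (*-cong (*-congʳ zpow≈) (⟦⟧-congʳ (suc a) (ℕₚ.+-comm k 1)))) ⟩
    (q^ e₁ ⊗ q^ e₂) ⊗ ⟦ m , a ⟧ ⊗ ⟦ suc k , suc a ⟧ ⊗ ⟦ i , k ∸ suc a ⟧ ⊗ y
      ≈⟨ solve 6 (λ p₁ p₂ x z w y → (p₁ :* p₂) :* x :* z :* w :* y := (p₁ :* x :* z) :* (p₂ :* w :* y)) refl _ _ _ _ _ _ ⟩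
    coeff k m a ⊗ (q^ e₂ ⊗ ⟦ i , k ∸ suc a ⟧ ⊗ y) ∎
    where
    e₁ = (k ∸ a) * (m ∸ a)
    e₂ = (i ∸ (k ∸ suc a)) * suc (m + suc a)
    zpow≈ : zpow q qinv (expo m k (suc i) (suc a)) ≈ q^ e₁ ⊗ q^ e₂
    zpow≈ = trans (reflexive (cong (zpow q qinv) (expo≡+ m k i a a<k a≤m A≤i))) (q^-+ e₁ e₂)

  summand-as-sum : ∀ qinv m n k a → a < k →
    coeff k m a ⊗ ⟦ suc (m + n) + a , suc (k + m) ⟧ ≈ ∑[ i < n ] summand qinv m n k (suc i) (suc a)
  summand-as-sum qinv m n k a a<k = begin
    coeff k m a ⊗ ⟦ suc (m + n) + a , suc (k + m) ⟧
      ≈⟨ *-congˡ (⟦⟧-cong top (≡.sym ([k∸suc[a]]+suc[m+suc[a]]≡suc[k+m] m a<k))) ⟩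
    coeff k m a ⊗ ⟦ b + n , A + suc b ⟧
      ≈⟨ *-congˡ (q-Vandermonde′ A b n) ⟨
    coeff k m a ⊗ ∑[ i < n ] (q^ ((i ∸ A) * suc b) ⊗ ⟦ i , A ⟧ ⊗ box b (n ∸ suc i))
      ≈⟨ *-distribˡ-∑ n _ _ ⟩
    ∑[ i < n ] (coeff k m a ⊗ (q^ ((i ∸ A) * suc b) ⊗ ⟦ i , A ⟧ ⊗ box b (n ∸ suc i)))
      ≈⟨ ∑-cong n (λ i i<n → trans (*-congˡ (last-factor i<n)) (zpow-factorization qinv m k a i _ a<k)) ⟨
    ∑[ i < n ] summand qinv m n k (suc i) (suc a) ∎
    where
    A = k ∸ suc a
    b = m + suc a
    top : suc (m + n) + a ≡ m + suc a + n
    top = solveℕ (m ∷ n ∷ a ∷ [])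
    last-factor : ∀ {i} → i < n → ⟦ m + n + suc a ∸ suc i , n ∸ suc i ⟧ ≈ box b (n ∸ suc i)
    last-factor {i} i<n = trans (⟦⟧-congʳ (n ∸ suc i) (vandermonde-index m a i<n)) (box-sym (n ∸ suc i) b)

corollary2p5 : ∀ {c ℓ} (R : CommutativeRing c ℓ) → let open QCalc R in
    (q qinv : Carrier) → q ⊗ qinv ≈ 1# → (m n k : ℕ) →
      (qbin q (m + n) k ⊗ qbin q (m + n + 1) n) ⊖ (qbin q m k ⊗ qbin q (k + m + n + 1) n)
        ≈ Σ1 n (λ i → Σ1 k (λ j →
             zpow q qinv (expo m k i j) ⊗ qbin q m (j ∸ 1) ⊗ qbin q (k + 1) j
               ⊗ qbin q (i ∸ 1) (k ∸ j) ⊗ qbin q (m + n + j ∸ i) (n ∸ i)))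
corollary2p5 R q qinv _ m n k = begin
  (⟦ m + n , k ⟧ ⊗ ⟦ m + n + 1 , n ⟧) ⊖ (⟦ m , k ⟧ ⊗ ⟦ k + m + n + 1 , n ⟧)
    ≈⟨ difference-as-sum m n k ⟩
  ∑[ a < k ] (coeff k m a ⊗ ⟦ suc (m + n) + a , suc (k + m) ⟧)
    ≈⟨ ∑-cong k (λ a a<k → summand-as-sum qinv m n k a a<k) ⟩
  ∑[ a < k ] ∑[ i < n ] summand qinv m n k (suc i) (suc a)
    ≈⟨ ∑-comm k n (λ a i → summand qinv m n k (suc i) (suc a)) ⟩
  ∑[ i < n ] ∑[ a < k ] summand qinv m n k (suc i) (suc a)
    ≈⟨ Σ1-Σ1≈∑-∑ n k (summand qinv m n k) ⟨
  Σ1 n (λ i → Σ1 k (summand qinv m n k i)) ∎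
  where
  open QCalc R
  open CommutativeRing R using (setoid)
  open import Relation.Binary.Reasoning.Setoid setoid
  open Sums R
  open QBinomials R q
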